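{- A word $w$ over a totally ordered alphabet is sortable by a $(2,1)$-pop stack of depth two if and only if $w$ avoids each of the patterns $120$, $201$, and $210$.
   Context: A word $w=w_1\cdots w_n$ contains a pattern $p=p_1\cdots p_m$ if there are indices $\alpha_1<\cdots<\alpha_m$ with $w_{\alpha_i}<w_{\alpha_j}$ iff $p_i<p_j$ and $w_{\alpha_i}=w_{\alpha_j}$ iff $p_i=p_j$; otherwise $w$ avoids $p$. A $(2,1)$-pop stack of depth two is the following device. Entries of $w$ are read from left to right. The contents of the device form a vertical sequence, in which maximal blocks of consecutive equal values are called value positions; at every stage the contents may contain entries of at most two distinct values. A push moves the next input entry into the device either on the top, or directly below the topmost block of equal values (i.e.\ into any of the top two value positions). A pop empties the entire device, moving all its entries to the end of the output in order from top to bottom. The word $w$ is sortable by the device if some admissible sequence of pushes and pops outputs all entries of $w$ in weakly increasing order. -}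

module Defs where

open import Data.Nat using (ℕ; _<_; _≤_; _≟_)
open import Data.Nat.Properties using (≤-totalOrder)
open import Data.List using (List; []; _∷_; _++_; length; lookup)
open import Data.List.Relation.Unary.All using (All)
open import Data.List.Relation.Unary.Sorted.TotalOrder ≤-totalOrder using (Sorted)
open import Data.Fin using (Fin) renaming (_<_ to _<ᶠ_)
open import Data.Product using (Σ; ∃; _×_; _,_)
open import Data.Sum using (_⊎_)
open import Relation.Nullary using (¬_; yes; no)
open import Relation.Binary.PropositionalEquality using (_≡_)
open import Relation.Binary.Construct.Closure.ReflexiveTransitive using (Star)
open import Function.Bundles using (_⇔_)

Word : Set
Word = List ℕ

Contains : Word → Word → Set
Contains w p =
  Σ (Fin (length p) → Fin (length w)) λ α →
    (∀ i j → i <ᶠ j → α i <ᶠ α j) ×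
    (∀ i j → (lookup w (α i) < lookup w (α j) ⇔ lookup p i < lookup p j)
           × (lookup w (α i) ≡ lookup w (α j) ⇔ lookup p i ≡ lookup p j))

Avoids : Word → Word → Set
Avoids w p = ¬ Contains w p

-- The (2,1)-pop stack of depth two.
-- Device contents are a list read from top to bottom.

insertBelow : ℕ → ℕ → List ℕ → List ℕ
insertBelow y x [] = x ∷ []
insertBelow y x (z ∷ s) with z ≟ y
... | yes _ = z ∷ insertBelow y x s
... | no  _ = x ∷ z ∷ s

pushBelowTop : ℕ → List ℕ → List ℕ
pushBelowTop x [] = x ∷ []
pushBelowTop x (y ∷ s) = y ∷ insertBelow y x s

AtMostTwoValues : List ℕ → Set
AtMostTwoValues s = ∃ λ a → ∃ λ b → All (λ x → x ≡ a ⊎ x ≡ b) s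

record Config : Set where
  constructor ⟨_,_,_⟩
  field
    input  : List ℕ
    device : List ℕ
    output : List ℕ

data Step : Config → Config → Set where
  pushTop   : ∀ {x w d o} → AtMostTwoValues (x ∷ d) →
              Step ⟨ x ∷ w , d , o ⟩ ⟨ w , x ∷ d , o ⟩
  pushBelow : ∀ {x w d o} → AtMostTwoValues (pushBelowTop x d) →
              Step ⟨ x ∷ w , d , o ⟩ ⟨ w , pushBelowTop x d , o ⟩
  pop       : ∀ {w d o} →
              Step ⟨ w , d , o ⟩ ⟨ w , [] , o ++ d ⟩

Sortable : Word → Set
Sortable w = ∃ λ out → Star Step ⟨ w , [] , [] ⟩ ⟨ [] , [] , out ⟩ × Sorted out

{-# OPTIONS --safe #-}
-- The patterns 120, 201 and 210 are exactly the orderings of three pairwise distinct letters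
-- r, s, t (occurring in this order) with t < r; call such an occurrence a forbidden triple.
--
-- A forbidden triple cannot be sorted. When t is read, either r has been output, and the
-- smaller t will come after it, or r is still in the device together with s (which cannot
-- leave without r), and t cannot join them as a third value. `Unsortable` collects the
-- configurations in which such a failure (or an inversion) is already committed; every step
-- preserves it, and a finished run with sorted output has none.
--
-- Conversely, a word without forbidden triples is sorted in rounds. A round starts with its
-- first letter x; copies of x join the block of x's, the first smaller letter a and its copies
-- are pushed on top of that block, and the round pops at the end of the input or before the
-- first letter h > x. Every later letter is then ≥ x, since x h z with z < x would be
-- forbidden, and no letter below x other than a occurs, since x a h would be forbidden. So each
-- round outputs a sorted block aⁱxʲ lying above the earlier output and below the remaining input.
module Submission where

open import Defs
open import Data.Nat using (ℕ; zero; suc; _+_; _<_; _≤_; _≟_; z≤n; z<s; s<s)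
open import Data.Nat.Properties
  using (≤-totalOrder; <-cmp; <-trans; <-irrefl; <-asym; ≤-refl; ≤-trans; <⇒≤; <⇒≢; >⇒≢; <⇒≱; ≮⇒≥;
         <-≤-trans; m≤n+m; +-monoˡ-<)
open import Data.List using (List; []; _∷_; _++_; length; lookup; map; replicate)
open import Data.List.Properties using (map-id)
open import Data.List.Membership.Propositional using (_∈_)
open import Data.List.Membership.Propositional.Properties using (∈-lookup; ∈-++⁺ˡ; ∈-++⁺ʳ)
open import Data.List.Relation.Unary.Any using (here; there)
open import Data.List.Relation.Unary.All as All using (All; []; _∷_)
open import Data.List.Relation.Unary.All.Properties using (++⁺; replicate⁺)
open import Data.List.Relation.Unary.AllPairs using (AllPairs; _∷_)
open import Data.List.Relation.Unary.Linked using ([]; [-]; _∷_)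
open import Data.List.Relation.Unary.Sorted.TotalOrder ≤-totalOrder using (Sorted)
open import Data.List.Relation.Unary.Sorted.TotalOrder.Properties using (Sorted⇒AllPairs)
open import Data.List.Relation.Binary.Sublist.Heterogeneous using (Sublist; _∷_; _∷ʳ_)
open import Data.List.Relation.Binary.Sublist.Heterogeneous.Properties using (map⁻)
open import Data.List.Relation.Binary.Sublist.Propositional using (_⊆_; ⊆-refl; ⊆-trans; minimum; from∈; to∈)
open import Data.List.Relation.Binary.Sublist.Propositional.Properties
  using (∷ˡ⁻) renaming (++⁺ to ⊆-++⁺; ++⁺ʳ to ⊆-++⁺ʳ)
open import Data.List.Relation.Binary.Permutation.Propositional using (_↭_; ↭-refl; ↭-prep; ↭-swap; ↭-trans)
open import Data.List.Relation.Binary.Permutation.Propositional.Properties using (∈-resp-↭)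
open import Data.Fin using (Fin; zero; suc; #_) renaming (_<_ to _<ᶠ_)
open import Data.Product using (∃; ∃₂; _×_; _,_; proj₁; proj₂)
open import Data.Sum using (_⊎_; inj₁; inj₂; [_,_])
open import Data.Empty using (⊥-elim)
open import Function using (_∘_; id)
open import Function.Bundles using (_⇔_; mk⇔; Equivalence)
open import Relation.Nullary using (¬_; yes; no; contradiction)
open import Relation.Binary using (REL; _Preserves_⟶_; tri<; tri≈; tri>)
open import Relation.Binary.PropositionalEquality using (_≡_; _≢_; refl; sym; cong; subst; subst₂)
open import Relation.Binary.Construct.Closure.ReflexiveTransitive using (Star; ε; _◅_)

sorted-++⁺ : ∀ {m xs ys} → Sorted xs → Sorted ys → All (_≤ m) xs → All (m ≤_) ys → Sorted (xs ++ ys)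
sorted-++⁺ []               ys↗ _          _         = ys↗
sorted-++⁺ {ys = []}    [-] _   _          _         = [-]
sorted-++⁺ {ys = _ ∷ _} [-] ys↗ (x≤m ∷ []) (m≤y ∷ _) = ≤-trans x≤m m≤y ∷ ys↗
sorted-++⁺ (x≤x′ ∷ xs↗)     ys↗ (_ ∷ xs≤m) m≤ys      = x≤x′ ∷ sorted-++⁺ xs↗ ys↗ xs≤m m≤ys

replicate-sorted : ∀ n {x} → Sorted (replicate n x)
replicate-sorted zero          = []
replicate-sorted (suc zero)    = [-]
replicate-sorted (suc (suc n)) = ≤-refl ∷ replicate-sorted (suc n)

module _ {a r} {A : Set a} {R : A → A → Set r} where

  AllPairs-⊆-pair : ∀ {xs y z} → AllPairs R xs → y ∷ z ∷ [] ⊆ xs → R y z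
  AllPairs-⊆-pair (_   ∷ Rxs) (_ ∷ʳ τ)   = AllPairs-⊆-pair Rxs τ
  AllPairs-⊆-pair (Rx ∷ _)    (refl ∷ τ) = All.lookup Rx (to∈ τ)

module _ {a b r} {A : Set a} {B : Set b} {R : REL A B r} where

  embed : ∀ {xs ys} → Sublist R xs ys → Fin (length xs) → Fin (length ys)
  embed (_ ∷ʳ τ) i       = suc (embed τ i)
  embed (_ ∷ τ)  zero    = zero
  embed (_ ∷ τ)  (suc i) = suc (embed τ i)

  embed-increasing : ∀ {xs ys} (τ : Sublist R xs ys) {i j} → i <ᶠ j → embed τ i <ᶠ embed τ j
  embed-increasing (_ ∷ʳ τ) i<j                       = s<s (embed-increasing τ i<j)
  embed-increasing (_ ∷ τ)  {zero}  {suc j} _         = z<s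
  embed-increasing (_ ∷ τ)  {suc i} {suc j} (s<s i<j) = s<s (embed-increasing τ i<j)

  embed-related : ∀ {xs ys} (τ : Sublist R xs ys) i → R (lookup xs i) (lookup ys (embed τ i))
  embed-related (_ ∷ʳ τ) i       = embed-related τ i
  embed-related (r ∷ τ)  zero    = r
  embed-related (_ ∷ τ)  (suc i) = embed-related τ i

module _ {a} {A : Set a} where

  lookup-pair-⊆ : ∀ (xs : List A) {i j} → i <ᶠ j → lookup xs i ∷ lookup xs j ∷ [] ⊆ xs
  lookup-pair-⊆ (x ∷ xs) {zero}  {suc j} _         = refl ∷ from∈ (∈-lookup j)
  lookup-pair-⊆ (x ∷ xs) {suc i} {suc j} (s<s i<j) = x ∷ʳ lookup-pair-⊆ xs i<j

  lookup-triple-⊆ : ∀ (xs : List A) {i j k} → i <ᶠ j → j <ᶠ k →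
                    lookup xs i ∷ lookup xs j ∷ lookup xs k ∷ [] ⊆ xs
  lookup-triple-⊆ (x ∷ xs) {zero}  {suc j} {suc k} _         (s<s j<k) = refl ∷ lookup-pair-⊆ xs j<k
  lookup-triple-⊆ (x ∷ xs) {suc i} {suc j} {suc k} (s<s i<j) (s<s j<k) = x ∷ʳ lookup-triple-⊆ xs i<j j<k

module _ {f : ℕ → ℕ} (f↑ : f Preserves _<_ ⟶ _<_) where

  strictMono⇒reflects-< : ∀ {x y} → f x < f y → x < y
  strictMono⇒reflects-< {x} {y} fx<fy with <-cmp x y
  ... | tri< x<y _ _  = x<y
  ... | tri≈ _ refl _ = contradiction fx<fy (<-irrefl refl)
  ... | tri> _ _ y<x  = contradiction fx<fy (<-asym (f↑ y<x))

  strictMono⇒injective : ∀ {x y} → f x ≡ f y → x ≡ y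
  strictMono⇒injective {x} {y} fx≡fy with <-cmp x y
  ... | tri< x<y _ _ = contradiction fx≡fy (<⇒≢ (f↑ x<y))
  ... | tri≈ _ x≡y _ = x≡y
  ... | tri> _ _ y<x = contradiction fx≡fy (>⇒≢ (f↑ y<x))

  strictMono-image⇒contains : ∀ {w} p → map f p ⊆ w → Contains w p
  strictMono-image⇒contains {w} p fp⊆w =
    embed τ , (λ _ _ → embed-increasing τ) , λ i j →
      subst₂ (λ u v → (u < v ⇔ _) × (u ≡ v ⇔ _)) (embed-related τ i) (embed-related τ j)
        (mk⇔ strictMono⇒reflects-< f↑ , mk⇔ strictMono⇒injective (cong f))
    where
    τ : Sublist (λ x y → f x ≡ y) p w
    τ = map⁻ f id (subst (map f p ⊆_) (sym (map-id w)) fp⊆w)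

-- `n + c` rather than `c + n`, so that `relabel a b c 2` is definitionally `c`.
relabel : ℕ → ℕ → ℕ → ℕ → ℕ
relabel a b c zero          = a
relabel a b c (suc zero)    = b
relabel a b c (suc (suc n)) = n + c

relabel-increasing : ∀ {a b c} → a < b → b < c → relabel a b c Preserves _<_ ⟶ _<_
relabel-increasing         a<b _   {zero}        {suc zero}    _               = a<b
relabel-increasing {c = c} a<b b<c {zero}        {suc (suc n)} _               =
  <-≤-trans (<-trans a<b b<c) (m≤n+m c n)
relabel-increasing {c = c} _   b<c {suc zero}    {suc (suc n)} _               = <-≤-trans b<c (m≤n+m c n)
relabel-increasing {c = c} _   _   {suc (suc m)} {suc (suc n)} (s<s (s<s m<n)) = +-monoˡ-< c m<n
relabel-increasing         _   _   {suc zero}    {suc zero}    (s<s ())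
relabel-increasing         _   _   {suc (suc m)} {suc zero}    (s<s ())

ForbiddenTriple : ℕ → ℕ → ℕ → Set
ForbiddenTriple r s t = r ≢ s × s ≢ t × t < r

HasForbiddenTriple : Word → Set
HasForbiddenTriple w = ∃₂ λ r s → ∃ λ t → ForbiddenTriple r s t × r ∷ s ∷ t ∷ [] ⊆ w

TripleFree : Word → Set
TripleFree w = ¬ HasForbiddenTriple w

tripleFree-⊆ : ∀ {u w} → u ⊆ w → TripleFree w → TripleFree u
tripleFree-⊆ u⊆w free (r , s , t , forbidden , τ) = free (r , s , t , forbidden , ⊆-trans τ u⊆w)

contains⇒hasForbiddenTriple : ∀ {w p₀ p₁ p₂} → ForbiddenTriple p₀ p₁ p₂ →
                              Contains w (p₀ ∷ p₁ ∷ p₂ ∷ []) → HasForbiddenTriple w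
contains⇒hasForbiddenTriple {w} (p₀≢p₁ , p₁≢p₂ , p₂<p₀) (α , α↑ , iso) =
  _ , _ , _ ,
  ( p₀≢p₁ ∘ Equivalence.to (proj₂ (iso (# 0) (# 1)))
  , p₁≢p₂ ∘ Equivalence.to (proj₂ (iso (# 1) (# 2)))
  , Equivalence.from (proj₁ (iso (# 2) (# 0))) p₂<p₀ ) ,
  lookup-triple-⊆ w (α↑ (# 0) (# 1) z<s) (α↑ (# 1) (# 2) (s<s z<s))

hasForbiddenTriple⇒contains : ∀ {w} → HasForbiddenTriple w →
  Contains w (1 ∷ 2 ∷ 0 ∷ []) ⊎ Contains w (2 ∷ 0 ∷ 1 ∷ []) ⊎ Contains w (2 ∷ 1 ∷ 0 ∷ [])
hasForbiddenTriple⇒contains (r , s , t , (r≢s , s≢t , t<r) , τ) with <-cmp r s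
... | tri< r<s _ _ = inj₁ (strictMono-image⇒contains (relabel-increasing t<r r<s) (1 ∷ 2 ∷ 0 ∷ []) τ)
... | tri≈ _ r≡s _ = contradiction r≡s r≢s
... | tri> _ _ s<r with <-cmp s t
...   | tri< s<t _ _ = inj₂ (inj₁ (strictMono-image⇒contains (relabel-increasing s<t t<r) (2 ∷ 0 ∷ 1 ∷ []) τ))
...   | tri≈ _ s≡t _ = contradiction s≡t s≢t
...   | tri> _ _ t<s = inj₂ (inj₂ (strictMono-image⇒contains (relabel-increasing t<s s<r) (2 ∷ 1 ∷ 0 ∷ []) τ))

insertBelow-↭ : ∀ y x s → x ∷ s ↭ insertBelow y x s
insertBelow-↭ y x []      = ↭-refl
insertBelow-↭ y x (z ∷ s) with z ≟ y
... | yes _ = ↭-trans (↭-swap x z ↭-refl) (↭-prep z (insertBelow-↭ y x s))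
... | no  _ = ↭-refl

pushBelowTop-↭ : ∀ x d → x ∷ d ↭ pushBelowTop x d
pushBelowTop-↭ x []      = ↭-refl
pushBelowTop-↭ x (y ∷ s) = ↭-trans (↭-swap x y ↭-refl) (↭-prep y (insertBelow-↭ y x s))

atMostTwoValues⇒¬forbidden : ∀ {d r s t} → AtMostTwoValues d → r ∈ d → s ∈ d → t ∈ d →
                             ¬ ForbiddenTriple r s t
atMostTwoValues⇒¬forbidden (_ , _ , d≡a⊎b) r∈d s∈d t∈d (r≢s , s≢t , t<r)
  with All.lookup d≡a⊎b r∈d | All.lookup d≡a⊎b s∈d | All.lookup d≡a⊎b t∈d
... | inj₁ refl | inj₁ refl | _         = r≢s refl
... | inj₂ refl | inj₂ refl | _         = r≢s refl
... | _         | inj₁ refl | inj₁ refl = s≢t refl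
... | _         | inj₂ refl | inj₂ refl = s≢t refl
... | inj₁ refl | _         | inj₁ refl = <-irrefl refl t<r
... | inj₂ refl | _         | inj₂ refl = <-irrefl refl t<r

data Unsortable : Config → Set where
  output-inversion        : ∀ {w d o y z} → z < y → y ∷ z ∷ [] ⊆ o → Unsortable ⟨ w , d , o ⟩
  output-device-inversion : ∀ {w d o y z} → z < y → y ∈ o → z ∈ d → Unsortable ⟨ w , d , o ⟩
  output-input-inversion  : ∀ {w d o y z} → z < y → y ∈ o → z ∈ w → Unsortable ⟨ w , d , o ⟩
  input-triple            : ∀ {w d o r s t} → ForbiddenTriple r s t →
                            r ∷ s ∷ t ∷ [] ⊆ w → Unsortable ⟨ w , d , o ⟩
  device-input-triple     : ∀ {w d o r s t} → ForbiddenTriple r s t →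
                            r ∈ d → s ∷ t ∷ [] ⊆ w → Unsortable ⟨ w , d , o ⟩
  device-device-triple    : ∀ {w d o r s t} → ForbiddenTriple r s t →
                            r ∈ d → s ∈ d → t ∈ w → Unsortable ⟨ w , d , o ⟩

push-unsortable : ∀ {x w d d′ o} → (∀ {z} → z ∈ x ∷ d → z ∈ d′) → AtMostTwoValues d′ →
                  Unsortable ⟨ x ∷ w , d , o ⟩ → Unsortable ⟨ w , d′ , o ⟩
push-unsortable _    _   (output-inversion z<y τ)                     = output-inversion z<y τ
push-unsortable grow _   (output-device-inversion z<y y∈o z∈d)        =
  output-device-inversion z<y y∈o (grow (there z∈d))
push-unsortable grow _   (output-input-inversion z<y y∈o (here refl)) =
  output-device-inversion z<y y∈o (grow (here refl))
push-unsortable _    _   (output-input-inversion z<y y∈o (there z∈w)) = output-input-inversion z<y y∈o z∈w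
push-unsortable _    _   (input-triple f (_ ∷ʳ τ))                    = input-triple f τ
push-unsortable grow _   (input-triple f (refl ∷ τ))                  = device-input-triple f (grow (here refl)) τ
push-unsortable grow _   (device-input-triple f r∈d (_ ∷ʳ τ))         = device-input-triple f (grow (there r∈d)) τ
push-unsortable grow _   (device-input-triple f r∈d (refl ∷ τ))       =
  device-device-triple f (grow (there r∈d)) (grow (here refl)) (to∈ τ)
push-unsortable grow _   (device-device-triple f r∈d s∈d (there t∈w)) =
  device-device-triple f (grow (there r∈d)) (grow (there s∈d)) t∈w
push-unsortable grow two (device-device-triple f r∈d s∈d (here refl)) =
  ⊥-elim (atMostTwoValues⇒¬forbidden two (grow (there r∈d)) (grow (there s∈d)) (grow (here refl)) f)

pop-unsortable : ∀ {w d o} → Unsortable ⟨ w , d , o ⟩ → Unsortable ⟨ w , [] , o ++ d ⟩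
pop-unsortable {d = d} (output-inversion z<y τ)              = output-inversion z<y (⊆-++⁺ʳ d τ)
pop-unsortable         (output-device-inversion z<y y∈o z∈d) = output-inversion z<y (⊆-++⁺ (from∈ y∈o) (from∈ z∈d))
pop-unsortable         (output-input-inversion z<y y∈o z∈w)  = output-input-inversion z<y (∈-++⁺ˡ y∈o) z∈w
pop-unsortable         (input-triple f τ)                    = input-triple f τ
pop-unsortable {o = o} (device-input-triple (_ , _ , t<r) r∈d τ) =
  output-input-inversion t<r (∈-++⁺ʳ o r∈d) (to∈ (∷ˡ⁻ τ))
pop-unsortable {o = o} (device-device-triple (_ , _ , t<r) r∈d _ t∈w) =
  output-input-inversion t<r (∈-++⁺ʳ o r∈d) t∈w

step-unsortable : ∀ {c c′} → Step c c′ → Unsortable c → Unsortable c′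
step-unsortable (pushTop two) = push-unsortable id two
step-unsortable {⟨ x ∷ _ , d , _ ⟩} (pushBelow two) = push-unsortable (∈-resp-↭ (pushBelowTop-↭ x d)) two
step-unsortable pop = pop-unsortable

run-unsortable : ∀ {c c′} → Star Step c c′ → Unsortable c → Unsortable c′
run-unsortable ε         u = u
run-unsortable (s ◅ run) u = run-unsortable run (step-unsortable s u)

unsortable⇒¬sorted : ∀ {out} → Unsortable ⟨ [] , [] , out ⟩ → ¬ Sorted out
unsortable⇒¬sorted (output-inversion z<y τ) out↗ =
  <⇒≱ z<y (AllPairs-⊆-pair (Sorted⇒AllPairs ≤-totalOrder out↗) τ)
unsortable⇒¬sorted (output-device-inversion _ _ ())
unsortable⇒¬sorted (output-input-inversion _ _ ())
unsortable⇒¬sorted (input-triple _ ())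
unsortable⇒¬sorted (device-input-triple _ () _)
unsortable⇒¬sorted (device-device-triple _ () _ _)

sortable⇒tripleFree : ∀ {w} → Sortable w → TripleFree w
sortable⇒tripleFree (_ , run , out↗) (_ , _ , _ , f , τ) =
  unsortable⇒¬sorted (run-unsortable run (input-triple f τ)) out↗

blocks : ℕ → ℕ → ℕ → ℕ → List ℕ
blocks a i x j = replicate i a ++ replicate j x

All-blocks : ∀ {P : ℕ → Set} {a x} i j → P a → P x → All P (blocks a i x j)
All-blocks i j Pa Px = ++⁺ (replicate⁺ i Pa) (replicate⁺ j Px)

blocks-sorted : ∀ {a x} i j → a ≤ x → Sorted (blocks a i x j)
blocks-sorted i j a≤x =
  sorted-++⁺ (replicate-sorted i) (replicate-sorted j) (replicate⁺ i ≤-refl) (replicate⁺ j a≤x)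

blocks-atMostTwoValues : ∀ a x i j → AtMostTwoValues (blocks a i x j)
blocks-atMostTwoValues a x i j = a , x , All-blocks i j (inj₁ refl) (inj₂ refl)

insertBelow-blocks : ∀ {a x} i j → x ≢ a → insertBelow a x (blocks a i x j) ≡ blocks a i x (suc j)
insertBelow-blocks         zero zero    _   = refl
insertBelow-blocks {a} {x} zero (suc j) x≢a with x ≟ a
... | yes x≡a = contradiction x≡a x≢a
... | no  _   = refl
insertBelow-blocks {a}     (suc i) j    x≢a with a ≟ a
... | yes _   = cong (a ∷_) (insertBelow-blocks i j x≢a)
... | no  a≢a = contradiction refl a≢a

pushBelow-blocks : ∀ {a x w o} i j → x ≢ a →
                   Step ⟨ x ∷ w , blocks a (suc i) x j , o ⟩ ⟨ w , blocks a (suc i) x (suc j) , o ⟩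
pushBelow-blocks {a} {x} {w} {o} i j x≢a =
  subst (λ d → Step ⟨ x ∷ w , blocks a (suc i) x j , o ⟩ ⟨ w , d , o ⟩) pushed
    (pushBelow (subst AtMostTwoValues (sym pushed) (blocks-atMostTwoValues a x (suc i) (suc j))))
  where
  pushed : pushBelowTop x (blocks a (suc i) x j) ≡ blocks a (suc i) x (suc j)
  pushed = cong (a ∷_) (insertBelow-blocks i j x≢a)

Completable : Config → Set
Completable c = ∃ λ out → Star Step c ⟨ [] , [] , out ⟩ × Sorted out

infixr 5 _◅ᶜ_
_◅ᶜ_ : ∀ {c c′} → Step c c′ → Completable c′ → Completable c
s ◅ᶜ (out , run , out↗) = out , s ◅ run , out↗

SortedBelow : ℕ → List ℕ → Set
SortedBelow m o = Sorted o × All (_≤ m) o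

sortedBelow-mono : ∀ {m n o} → m ≤ n → SortedBelow m o → SortedBelow n o
sortedBelow-mono m≤n (o↗ , o≤m) = o↗ , All.map (λ y≤m → ≤-trans y≤m m≤n) o≤m

sortedBelow-++-blocks : ∀ {a x o} i j → a ≤ x → SortedBelow a o → SortedBelow x (o ++ blocks a i x j)
sortedBelow-++-blocks i j a≤x (o↗ , o≤a) =
  sorted-++⁺ o↗ (blocks-sorted i j a≤x) o≤a (All-blocks i j ≤-refl a≤x) ,
  ++⁺ (All.map (λ y≤a → ≤-trans y≤a a≤x) o≤a) (All-blocks i j a≤x ≤-refl)

completed : ∀ {o} → Sorted o → Completable ⟨ [] , [] , o ⟩
completed {o} o↗ = o , ε , o↗

bounded-after-larger : ∀ {x h w} → x < h → TripleFree (x ∷ h ∷ w) → All (x ≤_) w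
bounded-after-larger {x} {h} x<h free = All.tabulate λ {z} z∈w → ≮⇒≥ λ z<x →
  free (x , h , z , (<⇒≢ x<h , >⇒≢ (<-trans z<x x<h) , z<x) , refl ∷ refl ∷ from∈ z∈w)

mutual
  startBlock-completable : ∀ {m o} x w → SortedBelow m o → m ≤ x → All (m ≤_) w →
                           TripleFree (x ∷ w) → Completable ⟨ x ∷ w , [] , o ⟩
  startBlock-completable x w o≤m m≤x m≤w free =
    pushTop (blocks-atMostTwoValues x x 0 1) ◅ᶜ oneBlock-completable 0 w o≤m m≤x m≤w free

  oneBlock-completable : ∀ {m x o} j w → SortedBelow m o → m ≤ x → All (m ≤_) w →
                         TripleFree (x ∷ w) → Completable ⟨ w , replicate (suc j) x , o ⟩
  oneBlock-completable j [] o≤m m≤x _ _ =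
    pop ◅ᶜ completed (proj₁ (sortedBelow-++-blocks 0 (suc j) ≤-refl (sortedBelow-mono m≤x o≤m)))
  oneBlock-completable {x = x} j (h ∷ w) o≤m m≤x (m≤h ∷ m≤w) free with <-cmp h x
  ... | tri< h<x _ _ =
    pushTop (blocks-atMostTwoValues h x 1 (suc j)) ◅ᶜ
    twoBlocks-completable 0 (suc j) w h<x (sortedBelow-mono m≤h o≤m) free
  ... | tri≈ _ refl _ =
    pushTop (blocks-atMostTwoValues x x 0 (suc (suc j))) ◅ᶜ
    oneBlock-completable (suc j) w o≤m m≤x m≤w (tripleFree-⊆ (x ∷ʳ ⊆-refl) free)
  ... | tri> _ _ x<h =
    pop ◅ᶜ startBlock-completable h w (sortedBelow-++-blocks 0 (suc j) ≤-refl (sortedBelow-mono m≤x o≤m))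
             (<⇒≤ x<h) (bounded-after-larger x<h free) (tripleFree-⊆ (x ∷ʳ ⊆-refl) free)

  twoBlocks-completable : ∀ {a x o} i j w → a < x → SortedBelow a o →
                          TripleFree (x ∷ a ∷ w) → Completable ⟨ w , blocks a (suc i) x j , o ⟩
  twoBlocks-completable i j [] a<x o≤a _ =
    pop ◅ᶜ completed (proj₁ (sortedBelow-++-blocks (suc i) j (<⇒≤ a<x) o≤a))
  twoBlocks-completable {a} {x} i j (h ∷ w) a<x o≤a free with <-cmp h x
  ... | tri> _ _ x<h =
    pop ◅ᶜ startBlock-completable h w (sortedBelow-++-blocks (suc i) j (<⇒≤ a<x) o≤a) (<⇒≤ x<h)
             (bounded-after-larger x<h (tripleFree-⊆ (refl ∷ a ∷ʳ ⊆-refl) free))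
             (tripleFree-⊆ (x ∷ʳ a ∷ʳ ⊆-refl) free)
  ... | tri≈ _ refl _ =
    pushBelow-blocks i j (>⇒≢ a<x) ◅ᶜ
    twoBlocks-completable i (suc j) w a<x o≤a (tripleFree-⊆ (refl ∷ refl ∷ x ∷ʳ ⊆-refl) free)
  ... | tri< h<x _ _ with h ≟ a
  ...   | yes refl =
    pushTop (blocks-atMostTwoValues a x (suc (suc i)) j) ◅ᶜ
    twoBlocks-completable (suc i) j w a<x o≤a (tripleFree-⊆ (refl ∷ refl ∷ a ∷ʳ ⊆-refl) free)
  ...   | no h≢a =
    contradiction (x , a , h , (>⇒≢ a<x , h≢a ∘ sym , h<x) , refl ∷ refl ∷ refl ∷ minimum w) free

tripleFree⇒sortable : ∀ w → TripleFree w → Sortable w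
tripleFree⇒sortable []      _    = completed []
tripleFree⇒sortable (x ∷ w) free =
  startBlock-completable x w ([] , []) z≤n (All.universal (λ _ → z≤n) w) free

mainTheorem14 : (w : Word) →
    Sortable w ⇔ (Avoids w (1 ∷ 2 ∷ 0 ∷ []) × Avoids w (2 ∷ 0 ∷ 1 ∷ []) × Avoids w (2 ∷ 1 ∷ 0 ∷ []))
mainTheorem14 w = mk⇔
  (λ sortable →
    avoids sortable ((λ ()) , (λ ()) , z<s) ,
    avoids sortable ((λ ()) , (λ ()) , s<s z<s) ,
    avoids sortable ((λ ()) , (λ ()) , z<s))
  (λ (avoids₁ , avoids₂ , avoids₃) → tripleFree⇒sortable w
    ([ avoids₁ , [ avoids₂ , avoids₃ ] ] ∘ hasForbiddenTriple⇒contains))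
  where
  avoids : ∀ {p₀ p₁ p₂} → Sortable w → ForbiddenTriple p₀ p₁ p₂ → Avoids w (p₀ ∷ p₁ ∷ p₂ ∷ [])
  avoids sortable forbidden = sortable⇒tripleFree sortable ∘ contains⇒hasForbiddenTriple forbidden
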